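{- Let $a,b,c$ be positive integers with $\gcd(a,b,c)=1$ and $a\mid{\rm lcm}(b,c)$. Put $l_1={\rm lcm}(a,b)$ and $l_2={\rm lcm}(a,c)$. If $\lambda$ is a complex number with $\lambda\ne 0$, $\lambda^{a}\ne1$, $\lambda^{b}\ne1$ and $\lambda^{c}=1$, then \begin{align*} \sum_{n\in{\rm NR}(a,b,c)}\lambda^n n&=\frac{l_2(\lambda^{l_1}-1)}{c(\lambda^a-1)(\lambda^b-1)}\left(l_1+\frac{l_2}{2}-a-b-\frac{c}{2}-\frac{a}{\lambda^a-1}-\frac{b}{\lambda^b-1}\right)\\ &\quad +\frac{l_1 l_2}{c(\lambda^a-1)(\lambda^b-1)}+\frac{\lambda}{(\lambda-1)^2}. \end{align*}
   Context: ${\rm NR}(a,b,c)$ denotes the (finite) set of positive integers that cannot be written as $xa+yb+zc$ with nonnegative integers $x,y,z$. -}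

module Defs where

open import Level using (Level; _⊔_) renaming (suc to lsuc)
open import Data.Nat as ℕ using (ℕ; zero; suc)
open import Data.Product using (Σ; ∃; _×_; _,_)
open import Data.List using (List; []; _∷_)
open import Relation.Nullary using (¬_)
open import Relation.Binary.PropositionalEquality using (_≡_)
open import Algebra.Bundles using (CommutativeRing)

Representable : ℕ → ℕ → ℕ → ℕ → Set
Representable a b c n =
  ∃ λ x → ∃ λ y → ∃ λ z → x ℕ.* a ℕ.+ y ℕ.* b ℕ.+ z ℕ.* c ≡ n

InNR : ℕ → ℕ → ℕ → ℕ → Set
InNR a b c n = (1 ℕ.≤ n) × ¬ Representable a b c n

module RingOps {c ℓ : Level} (R : CommutativeRing c ℓ) where
  open CommutativeRing R

  fromℕ : ℕ → Carrier
  fromℕ zero = 0#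
  fromℕ (suc n) = 1# + fromℕ n

  _^_ : Carrier → ℕ → Carrier
  x ^ zero = 1#
  x ^ suc n = x * (x ^ n)

-- A field of characteristic zero (the stdlib has no Field bundle):
-- a commutative ring with a (total) inversion map that is a genuine
-- inverse on nonzero elements, and n·1 ≠ 0 for every n ≥ 1.
record CharZeroField (c ℓ : Level) : Set (lsuc (c ⊔ ℓ)) where
  field
    cring : CommutativeRing c ℓ
  open CommutativeRing cring public
  open RingOps cring public
  field
    _⁻¹ : Carrier → Carrier
    ⁻¹-inverse : ∀ x → ¬ (x ≈ 0#) → (x * (x ⁻¹)) ≈ 1#
    char0 : ∀ n → ¬ (fromℕ (suc n) ≈ 0#)

  _/_ : Carrier → Carrier → Carrier
  x / y = x * (y ⁻¹)

  weightedSum : Carrier → List ℕ → Carrier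
  weightedSum λ' [] = 0#
  weightedSum λ' (n ∷ ns) = ((λ' ^ n) * fromℕ n) + weightedSum λ' ns

{-# OPTIONS --safe #-}
-- Write g = gcd a b and h = gcd a c. The hypotheses give a = g h, lcm a b = h b and
-- lcm a c = g c, and every representation x a + y b + z c can be normalised to one with
-- y < h and z < g, which is then unique. Hence the numbers y b + z c (y < h, z < g) form a
-- complete residue system mod a, each the least representable number of its class: if
-- y b + z c = r + T a with r < a, the non-representable numbers ≡ r are the r + i a, i < T.
-- Along each class ∑ λⁿ n is an arithmetico-geometric sum, which telescopes to
-- φ (y b + z c) - φ r with φ n = λⁿ (n (λᵃ - 1) - a λᵃ). As λᶜ = 1, λ^(y b + z c) = (λᵇ)ʸ,
-- so the terms φ (y b + z c) add up to geometric sums in λᵇ of length h, while the terms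
-- φ r (r < a) add up to -(λᵃ - 1)² λ / (λ - 1)². Clearing denominators leaves a polynomial
-- identity.
module Submission where

open import Defs
open import Level using (Level)
open import Algebra.Bundles using (CommutativeRing; CommutativeSemiring)
open import Data.Nat.Base as ℕ using (ℕ; zero; suc; _≤_; _<_; z≤n; s≤s; NonZero)
import Data.Nat.Properties as ℕ
open import Data.Nat.Divisibility using (_∣_)
open import Data.Nat.GCD using (gcd)
open import Data.Nat.LCM using (lcm)
open import Data.Integer.Base as ℤ using (ℤ; 0ℤ; 1ℤ)
open import Data.Product.Base using (∃; _×_; _,_; proj₁; proj₂)
open import Data.Sum.Base using (inj₁; inj₂)
open import Data.List.Base using (List; []; _∷_)
open import Data.List.Membership.Propositional using (_∈_)
open import Data.List.Membership.DecPropositional ℕ._≟_ using (_∈?_)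
open import Data.List.Relation.Unary.Any using (here; there)
open import Data.List.Relation.Unary.Unique.Propositional using (Unique; _∷_)
import Data.List.Relation.Unary.All as All
open import Function.Base using (_∘_)
open import Function.Bundles using (_⇔_; Equivalence; mk⇔)
open import Relation.Nullary using (¬_; Dec; yes; no; contradiction)
open import Relation.Nullary.Decidable using (_×-dec_)
open import Relation.Binary.PropositionalEquality.Core as ≡ using (_≡_)

-- Algebra.Solver.Ring needs coefficients with decidable equality; ℤ, mapped into R by
-- n ↦ n · 1#, serves every commutative ring. The type-checking optimised multiple _×′_ makes
-- the coefficient 1ℤ denote 1# itself, so that solver goals match terms written with 1#.
module ℤ-CoefficientSolver {c ℓ} (R : CommutativeRing c ℓ) where
  open import Data.Integer.Base using (+_; -[1+_]; _⊖_; _◃_; sign; ∣_∣)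
  import Data.Integer.Properties as ℤ
  open import Data.Sign.Base as Sign using (Sign)
  open import Data.Maybe.Base using (Maybe; map)
  open import Relation.Binary.Consequences using (dec⇒weaklyDec)
  open import Algebra.Solver.Ring.AlmostCommutativeRing using (fromCommutativeRing; _-Raw-AlmostCommutative⟶_)
  open CommutativeRing R
  open import Algebra.Properties.Ring ring using (-‿involutive; -0#≈0#; -‿+-comm; -1*x≈-x)
  open import Algebra.Properties.CommutativeSemigroup +-commutativeSemigroup
    using () renaming (interchange to +-interchange)
  open import Algebra.Properties.CommutativeSemigroup *-commutativeSemigroup
    using () renaming (interchange to *-interchange)
  open import Algebra.Properties.Semiring.Mult.TCOptimised semiring using (1+×; ×-homo-+; ×1-homo-*) renaming (_×_ to _×′_)
  open import Relation.Binary.Reasoning.Setoid setoid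

  ⟦_⟧ℤ : ℤ → Carrier
  ⟦ + n ⟧ℤ = n ×′ 1#
  ⟦ -[1+ n ] ⟧ℤ = - (suc n ×′ 1#)

  ⟦_⟧± : Sign → Carrier
  ⟦ Sign.+ ⟧± = 1#
  ⟦ Sign.- ⟧± = - 1#

  [x+y]-[x+z]≈y-z : ∀ x y z → (x + y) - (x + z) ≈ y - z
  [x+y]-[x+z]≈y-z x y z = begin
    (x + y) + - (x + z)   ≈⟨ +-congˡ (-‿+-comm x z) ⟨
    (x + y) + (- x + - z) ≈⟨ +-interchange x y (- x) (- z) ⟩
    (x - x) + (y - z)     ≈⟨ +-congʳ (-‿inverseʳ x) ⟩
    0# + (y - z)          ≈⟨ +-identityˡ _ ⟩
    y - z                 ∎

  ⊖-homo : ∀ m n → ⟦ m ⊖ n ⟧ℤ ≈ m ×′ 1# - n ×′ 1#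
  ⊖-homo m zero = sym (trans (+-congˡ -0#≈0#) (+-identityʳ _))
  ⊖-homo zero (suc n) = sym (+-identityˡ _)
  ⊖-homo (suc m) (suc n) = begin
    ⟦ suc m ⊖ suc n ⟧ℤ                ≡⟨ ≡.cong ⟦_⟧ℤ (ℤ.[1+m]⊖[1+n]≡m⊖n m n) ⟩
    ⟦ m ⊖ n ⟧ℤ                        ≈⟨ ⊖-homo m n ⟩
    m ×′ 1# - n ×′ 1#                 ≈⟨ [x+y]-[x+z]≈y-z 1# _ _ ⟨
    (1# + m ×′ 1#) - (1# + n ×′ 1#)   ≈⟨ +-cong (1+× m 1#) (-‿cong (1+× n 1#)) ⟨
    suc m ×′ 1# - suc n ×′ 1#         ∎

  ◃-homo : ∀ s n → ⟦ s ◃ n ⟧ℤ ≈ ⟦ s ⟧± * (n ×′ 1#)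
  ◃-homo s zero = sym (zeroʳ _)
  ◃-homo Sign.+ (suc n) = sym (*-identityˡ _)
  ◃-homo Sign.- (suc n) = sym (-1*x≈-x _)

  sign-homo : ∀ s t → ⟦ s Sign.* t ⟧± ≈ ⟦ s ⟧± * ⟦ t ⟧±
  sign-homo Sign.+ t = sym (*-identityˡ _)
  sign-homo Sign.- Sign.+ = sym (*-identityʳ _)
  sign-homo Sign.- Sign.- = sym (trans (-1*x≈-x _) (-‿involutive 1#))

  sign-abs : ∀ i → ⟦ i ⟧ℤ ≈ ⟦ sign i ⟧± * (∣ i ∣ ×′ 1#)
  sign-abs i = trans (reflexive (≡.cong ⟦_⟧ℤ (≡.sym (ℤ.◃-inverse i)))) (◃-homo (sign i) ∣ i ∣)

  +-homo : ∀ i j → ⟦ i ℤ.+ j ⟧ℤ ≈ ⟦ i ⟧ℤ + ⟦ j ⟧ℤ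
  +-homo (+ m) (+ n) = ×-homo-+ 1# m n
  +-homo (+ m) -[1+ n ] = ⊖-homo m (suc n)
  +-homo -[1+ m ] (+ n) = trans (⊖-homo n (suc m)) (+-comm _ _)
  +-homo -[1+ m ] -[1+ n ] = begin
    - (suc (suc m ℕ.+ n) ×′ 1#)         ≡⟨ ≡.cong (λ k → - (suc k ×′ 1#)) (ℕ.+-suc m n) ⟨
    - ((suc m ℕ.+ suc n) ×′ 1#)         ≈⟨ -‿cong (×-homo-+ 1# (suc m) (suc n)) ⟩
    - (suc m ×′ 1# + suc n ×′ 1#)       ≈⟨ -‿+-comm _ _ ⟨
    - (suc m ×′ 1#) + - (suc n ×′ 1#)   ∎

  *-homo : ∀ i j → ⟦ i ℤ.* j ⟧ℤ ≈ ⟦ i ⟧ℤ * ⟦ j ⟧ℤ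
  *-homo i j = begin
    ⟦ i ℤ.* j ⟧ℤ                                                   ≈⟨ ◃-homo (sign i Sign.* sign j) (∣ i ∣ ℕ.* ∣ j ∣) ⟩
    ⟦ sign i Sign.* sign j ⟧± * ((∣ i ∣ ℕ.* ∣ j ∣) ×′ 1#)          ≈⟨ *-cong (sign-homo (sign i) (sign j)) (×1-homo-* ∣ i ∣ ∣ j ∣) ⟩
    (⟦ sign i ⟧± * ⟦ sign j ⟧±) * ((∣ i ∣ ×′ 1#) * (∣ j ∣ ×′ 1#))  ≈⟨ *-interchange _ _ _ _ ⟩
    (⟦ sign i ⟧± * (∣ i ∣ ×′ 1#)) * (⟦ sign j ⟧± * (∣ j ∣ ×′ 1#))  ≈⟨ *-cong (sign-abs i) (sign-abs j) ⟨
    ⟦ i ⟧ℤ * ⟦ j ⟧ℤ                                                ∎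

  -‿homo : ∀ i → ⟦ ℤ.- i ⟧ℤ ≈ - ⟦ i ⟧ℤ
  -‿homo (+ zero) = sym -0#≈0#
  -‿homo (+ suc n) = refl
  -‿homo -[1+ n ] = sym (-‿involutive _)

  homomorphism : ℤ.+-*-rawRing -Raw-AlmostCommutative⟶ fromCommutativeRing R
  homomorphism = record
    { ⟦_⟧ = ⟦_⟧ℤ
    ; +-homo = +-homo
    ; *-homo = *-homo
    ; -‿homo = -‿homo
    ; 0-homo = refl
    ; 1-homo = refl
    }

  ⟦⟧ℤ-≟ : ∀ i j → Maybe (⟦ i ⟧ℤ ≈ ⟦ j ⟧ℤ)
  ⟦⟧ℤ-≟ i j = map (λ { ≡.refl → refl }) (dec⇒weaklyDec ℤ._≟_ i j)

  open import Algebra.Solver.Ring ℤ.+-*-rawRing (fromCommutativeRing R) homomorphism ⟦⟧ℤ-≟ public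


module FiniteSums {c ℓ} (R : CommutativeSemiring c ℓ) where
  open CommutativeSemiring R
  open import Relation.Binary.Reasoning.Setoid setoid

  ∑< : ℕ → (ℕ → Carrier) → Carrier
  ∑< zero f = 0#
  ∑< (suc n) f = ∑< n f + f n

  infixl 10 ∑<
  syntax ∑< n (λ i → x) = ∑[ i < n ] x

  ∑-cong : ∀ n {f g} → (∀ i → i < n → f i ≈ g i) → ∑< n f ≈ ∑< n g
  ∑-cong zero f≈g = refl
  ∑-cong (suc n) f≈g = +-cong (∑-cong n (λ i i<n → f≈g i (ℕ.m<n⇒m<1+n i<n))) (f≈g n ℕ.≤-refl)

  ∑-zero : ∀ n {f} → (∀ i → i < n → f i ≈ 0#) → ∑< n f ≈ 0#
  ∑-zero n f≈0 = trans (∑-cong n f≈0) (zero-sum n)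
    where
    zero-sum : ∀ n → ∑[ i < n ] 0# ≈ 0#
    zero-sum zero = refl
    zero-sum (suc n) = trans (+-identityʳ _) (zero-sum n)

  ∑-distrib-+ : ∀ n f g → ∑[ i < n ] (f i + g i) ≈ ∑< n f + ∑< n g
  ∑-distrib-+ zero f g = sym (+-identityˡ 0#)
  ∑-distrib-+ (suc n) f g = trans (+-congʳ (∑-distrib-+ n f g)) (+-interchange _ _ _ _)
    where open import Algebra.Properties.CommutativeSemigroup +-commutativeSemigroup
            using () renaming (interchange to +-interchange)

  *-distribˡ-∑ : ∀ n x f → x * ∑< n f ≈ ∑[ i < n ] (x * f i)
  *-distribˡ-∑ zero x f = zeroʳ x
  *-distribˡ-∑ (suc n) x f = trans (distribˡ x _ _) (+-congʳ (*-distribˡ-∑ n x f))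

  *-distribʳ-∑ : ∀ n x f → ∑< n f * x ≈ ∑[ i < n ] (f i * x)
  *-distribʳ-∑ n x f = trans (*-comm _ x) (trans (*-distribˡ-∑ n x f) (∑-cong n (λ i _ → *-comm x (f i))))

  ∑-linear : ∀ n u v f g → ∑[ i < n ] (u * f i + v * g i) ≈ u * ∑< n f + v * ∑< n g
  ∑-linear n u v f g = trans (∑-distrib-+ n _ _) (sym (+-cong (*-distribˡ-∑ n u f) (*-distribˡ-∑ n v g)))

  ∑-split : ∀ m k f → ∑< (m ℕ.+ k) f ≈ ∑< m f + ∑[ j < k ] f (m ℕ.+ j)
  ∑-split m zero f = trans (reflexive (≡.cong (λ n → ∑< n f) (ℕ.+-identityʳ m))) (sym (+-identityʳ _))
  ∑-split m (suc k) f = begin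
    ∑< (m ℕ.+ suc k) f                                ≡⟨ ≡.cong (λ n → ∑< n f) (ℕ.+-suc m k) ⟩
    ∑< (m ℕ.+ k) f + f (m ℕ.+ k)                      ≈⟨ +-congʳ (∑-split m k f) ⟩
    (∑< m f + ∑[ j < k ] f (m ℕ.+ j)) + f (m ℕ.+ k)   ≈⟨ +-assoc _ _ _ ⟩
    ∑< m f + ∑[ j < suc k ] f (m ℕ.+ j)               ∎

  ∑-comm : ∀ m n (f : ℕ → ℕ → Carrier) → ∑[ i < m ] ∑[ j < n ] f i j ≈ ∑[ j < n ] ∑[ i < m ] f i j
  ∑-comm zero n f = sym (∑-zero n (λ _ _ → refl))
  ∑-comm (suc m) n f = trans (+-congʳ (∑-comm m n f)) (sym (∑-distrib-+ n _ _))

  ∑-residues : ∀ k a f → ∑< (k ℕ.* a) f ≈ ∑[ r < a ] ∑[ i < k ] f (r ℕ.+ i ℕ.* a)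
  ∑-residues k a f = trans (blocks k) (∑-comm k a _)
    where
    blocks : ∀ k → ∑< (k ℕ.* a) f ≈ ∑[ i < k ] ∑[ r < a ] f (r ℕ.+ i ℕ.* a)
    blocks zero = refl
    blocks (suc k) = begin
      ∑< (a ℕ.+ k ℕ.* a) f
        ≡⟨ ≡.cong (λ n → ∑< n f) (ℕ.+-comm a (k ℕ.* a)) ⟩
      ∑< (k ℕ.* a ℕ.+ a) f
        ≈⟨ ∑-split (k ℕ.* a) a f ⟩
      ∑< (k ℕ.* a) f + ∑[ r < a ] f (k ℕ.* a ℕ.+ r)
        ≈⟨ +-cong (blocks k) (∑-cong a (λ r _ → reflexive (≡.cong f (ℕ.+-comm (k ℕ.* a) r)))) ⟩
      ∑[ i < k ] ∑[ r < a ] f (r ℕ.+ i ℕ.* a) + ∑[ r < a ] f (r ℕ.+ k ℕ.* a)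
        ∎

  𝟙 : ∀ {p} {P : Set p} → Dec P → Carrier
  𝟙 (yes _) = 1#
  𝟙 (no _) = 0#

  𝟙-cong : ∀ {p q} {P : Set p} {Q : Set q} (P? : Dec P) (Q? : Dec Q) → P ⇔ Q → 𝟙 P? ≈ 𝟙 Q?
  𝟙-cong (yes _) (yes _) _ = refl
  𝟙-cong (no _) (no _) _ = refl
  𝟙-cong (yes p) (no ¬q) P⇔Q = contradiction (Equivalence.to P⇔Q p) ¬q
  𝟙-cong (no ¬p) (yes q) P⇔Q = contradiction (Equivalence.from P⇔Q q) ¬p

  𝟙-× : ∀ {p q} {P : Set p} {Q : Set q} (P? : Dec P) (Q? : Dec Q) → 𝟙 (P? ×-dec Q?) ≈ 𝟙 P? * 𝟙 Q?
  𝟙-× (yes _) (yes _) = sym (*-identityˡ 1#)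
  𝟙-× (yes _) (no _) = sym (zeroʳ 1#)
  𝟙-× (no _) Q? = sym (zeroˡ _)

  ∑-𝟙-≡ : ∀ n x (f : ℕ → Carrier) → x < n → ∑[ i < n ] (𝟙 (i ℕ.≟ x) * f i) ≈ f x
  ∑-𝟙-≡ (suc n) x f x<1+n with n ℕ.≟ x
  ... | yes ≡.refl = begin
    ∑[ i < n ] (𝟙 (i ℕ.≟ n) * f i) + 1# * f n ≈⟨ +-cong (∑-zero n off-diagonal) (*-identityˡ (f n)) ⟩
    0# + f n                                  ≈⟨ +-identityˡ (f n) ⟩
    f n                                       ∎
    where
    off-diagonal : ∀ i → i < n → 𝟙 (i ℕ.≟ n) * f i ≈ 0#
    off-diagonal i i<n with i ℕ.≟ n
    ... | yes ≡.refl = contradiction i<n (ℕ.<-irrefl ≡.refl)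
    ... | no _ = zeroˡ (f i)
  ... | no n≢x = trans (+-cong (∑-𝟙-≡ n x f x<n) (zeroˡ (f n))) (+-identityʳ (f x))
    where x<n = ℕ.≤∧≢⇒< (ℕ.≤-pred x<1+n) (λ x≡n → n≢x (≡.sym x≡n))

  ∑-𝟙-< : ∀ n t (f : ℕ → Carrier) → t ≤ n → ∑[ i < n ] (𝟙 (i ℕ.<? t) * f i) ≈ ∑< t f
  ∑-𝟙-< n t f t≤n = begin
    ∑[ i < n ] (𝟙 (i ℕ.<? t) * f i)
      ≡⟨ ≡.cong (λ m → ∑[ i < m ] (𝟙 (i ℕ.<? t) * f i)) (ℕ.m+[n∸m]≡n t≤n) ⟨
    ∑[ i < t ℕ.+ (n ℕ.∸ t) ] (𝟙 (i ℕ.<? t) * f i)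
      ≈⟨ ∑-split t (n ℕ.∸ t) _ ⟩
    ∑[ i < t ] (𝟙 (i ℕ.<? t) * f i) + ∑[ j < n ℕ.∸ t ] (𝟙 (t ℕ.+ j ℕ.<? t) * f (t ℕ.+ j))
      ≈⟨ +-cong (∑-cong t below) (∑-zero (n ℕ.∸ t) (λ j _ → above j)) ⟩
    ∑< t f + 0#
      ≈⟨ +-identityʳ _ ⟩
    ∑< t f
      ∎
    where
    below : ∀ i → i < t → 𝟙 (i ℕ.<? t) * f i ≈ f i
    below i i<t with i ℕ.<? t
    ... | yes _ = *-identityˡ (f i)
    ... | no i≮t = contradiction i<t i≮t
    above : ∀ j → 𝟙 (t ℕ.+ j ℕ.<? t) * f (t ℕ.+ j) ≈ 0#
    above j with t ℕ.+ j ℕ.<? t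
    ... | yes t+j<t = contradiction (ℕ.m≤m+n t j) (ℕ.<⇒≱ t+j<t)
    ... | no _ = zeroˡ _

  ∑²-𝟙-≡ : ∀ h g {y₀ z₀} → y₀ < h → z₀ < g → ∑[ y < h ] ∑[ z < g ] (𝟙 (y ℕ.≟ y₀) * 𝟙 (z ℕ.≟ z₀)) ≈ 1#
  ∑²-𝟙-≡ h g {y₀} {z₀} y₀<h z₀<g = begin
    ∑[ y < h ] ∑[ z < g ] (𝟙 (y ℕ.≟ y₀) * 𝟙 (z ℕ.≟ z₀))
      ≈⟨ ∑-cong h (λ y _ → ∑-cong g (λ z _ → *-congˡ (*-identityʳ _))) ⟨
    ∑[ y < h ] ∑[ z < g ] (𝟙 (y ℕ.≟ y₀) * (𝟙 (z ℕ.≟ z₀) * 1#))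
      ≈⟨ ∑-cong h (λ y _ → *-distribˡ-∑ g _ _) ⟨
    ∑[ y < h ] (𝟙 (y ℕ.≟ y₀) * ∑[ z < g ] (𝟙 (z ℕ.≟ z₀) * 1#))
      ≈⟨ ∑-cong h (λ y _ → *-congˡ (∑-𝟙-≡ g z₀ (λ _ → 1#) z₀<g)) ⟩
    ∑[ y < h ] (𝟙 (y ℕ.≟ y₀) * 1#)
      ≈⟨ ∑-𝟙-≡ h y₀ (λ _ → 1#) y₀<h ⟩
    1#
      ∎

  ∑-bijection : ∀ n h g (ρ : ℕ → ℕ → ℕ) (π₁ π₂ : ℕ → ℕ) →
    (∀ {y z} → y < h → z < g → ρ y z < n) →
    (∀ {r} → r < n → π₁ r < h × π₂ r < g × ρ (π₁ r) (π₂ r) ≡ r) →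
    (∀ {y z} → y < h → z < g → π₁ (ρ y z) ≡ y × π₂ (ρ y z) ≡ z) →
    ∀ (F : ℕ → ℕ → Carrier) → ∑[ r < n ] F (π₁ r) (π₂ r) ≈ ∑[ y < h ] ∑[ z < g ] F y z
  ∑-bijection n h g ρ π₁ π₂ ρ<n π-section π-retraction F = sym (begin
    ∑[ y < h ] ∑[ z < g ] F y z
      ≈⟨ ∑-cong h (λ y y<h → ∑-cong g (λ z z<g → pick y<h z<g)) ⟩
    ∑[ y < h ] ∑[ z < g ] ∑[ r < n ] (𝟙 (r ℕ.≟ ρ y z) * G r)
      ≈⟨ ∑-cong h (λ y _ → ∑-comm g n _) ⟩
    ∑[ y < h ] ∑[ r < n ] ∑[ z < g ] (𝟙 (r ℕ.≟ ρ y z) * G r)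
      ≈⟨ ∑-comm h n _ ⟩
    ∑[ r < n ] ∑[ y < h ] ∑[ z < g ] (𝟙 (r ℕ.≟ ρ y z) * G r)
      ≈⟨ ∑-cong n (λ r _ → factor r) ⟩
    ∑[ r < n ] ((∑[ y < h ] ∑[ z < g ] 𝟙 (r ℕ.≟ ρ y z)) * G r)
      ≈⟨ ∑-cong n (λ r r<n → trans (*-congʳ (one-preimage r<n)) (*-identityˡ (G r))) ⟩
    ∑[ r < n ] G r
      ∎)
    where
    G : ℕ → Carrier
    G r = F (π₁ r) (π₂ r)

    pick : ∀ {y z} → y < h → z < g → F y z ≈ ∑[ r < n ] (𝟙 (r ℕ.≟ ρ y z) * G r)
    pick {y} {z} y<h z<g with π-retraction y<h z<g
    ... | π₁ρ≡y , π₂ρ≡z = sym (trans (∑-𝟙-≡ n (ρ y z) G (ρ<n y<h z<g)) (reflexive (≡.cong₂ F π₁ρ≡y π₂ρ≡z)))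

    factor : ∀ r → ∑[ y < h ] ∑[ z < g ] (𝟙 (r ℕ.≟ ρ y z) * G r) ≈ (∑[ y < h ] ∑[ z < g ] 𝟙 (r ℕ.≟ ρ y z)) * G r
    factor r = sym (trans (*-distribʳ-∑ h (G r) _) (∑-cong h (λ y _ → *-distribʳ-∑ g (G r) _)))

    one-preimage : ∀ {r} → r < n → ∑[ y < h ] ∑[ z < g ] 𝟙 (r ℕ.≟ ρ y z) ≈ 1#
    one-preimage {r} r<n with π-section r<n
    ... | π₁r<h , π₂r<g , ρπ≡r =
      trans (∑-cong h (λ y y<h → ∑-cong g (λ z z<g → separate y<h z<g))) (∑²-𝟙-≡ h g π₁r<h π₂r<g)
      where
      same-point : ∀ {y z} → y < h → z < g → r ≡ ρ y z ⇔ (y ≡ π₁ r × z ≡ π₂ r)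
      same-point y<h z<g = mk⇔
        (λ { ≡.refl → ≡.sym (proj₁ (π-retraction y<h z<g)) , ≡.sym (proj₂ (π-retraction y<h z<g)) })
        (λ { (≡.refl , ≡.refl) → ≡.sym ρπ≡r })
      separate : ∀ {y z} → y < h → z < g → 𝟙 (r ℕ.≟ ρ y z) ≈ 𝟙 (y ℕ.≟ π₁ r) * 𝟙 (z ℕ.≟ π₂ r)
      separate {y} {z} y<h z<g =
        trans (𝟙-cong (r ℕ.≟ ρ y z) ((y ℕ.≟ π₁ r) ×-dec (z ℕ.≟ π₂ r)) (same-point y<h z<g)) (𝟙-× (y ℕ.≟ π₁ r) (z ℕ.≟ π₂ r))

module FieldLemmas {ℓc ℓe : Level} (F : CharZeroField ℓc ℓe) where
  open CharZeroField F
  open import Algebra.Properties.Semiring.Mult semiring using (×-homo-+; ×1-homo-*) renaming (_×_ to _×ᵤ_)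
  import Algebra.Properties.Semiring.Exp semiring as Exp
  open import Relation.Binary.Reasoning.Setoid setoid
  open ℤ-CoefficientSolver cring using (solve; _:=_; _:+_; _:-_; :-_; _:*_; con)
  open FiniteSums commutativeSemiring public

  fromℕ≡×1# : ∀ n → fromℕ n ≡ n ×ᵤ 1#
  fromℕ≡×1# zero = ≡.refl
  fromℕ≡×1# (suc n) = ≡.cong (1# +_) (fromℕ≡×1# n)

  fromℕ-+ : ∀ m n → fromℕ (m ℕ.+ n) ≈ fromℕ m + fromℕ n
  fromℕ-+ m n = begin
    fromℕ (m ℕ.+ n)      ≡⟨ fromℕ≡×1# (m ℕ.+ n) ⟩
    (m ℕ.+ n) ×ᵤ 1#      ≈⟨ ×-homo-+ 1# m n ⟩
    m ×ᵤ 1# + n ×ᵤ 1#    ≡⟨ ≡.cong₂ _+_ (fromℕ≡×1# m) (fromℕ≡×1# n) ⟨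
    fromℕ m + fromℕ n    ∎

  fromℕ-* : ∀ m n → fromℕ (m ℕ.* n) ≈ fromℕ m * fromℕ n
  fromℕ-* m n = begin
    fromℕ (m ℕ.* n)      ≡⟨ fromℕ≡×1# (m ℕ.* n) ⟩
    (m ℕ.* n) ×ᵤ 1#      ≈⟨ ×1-homo-* m n ⟩
    m ×ᵤ 1# * n ×ᵤ 1#    ≡⟨ ≡.cong₂ _*_ (fromℕ≡×1# m) (fromℕ≡×1# n) ⟨
    fromℕ m * fromℕ n    ∎

  fromℕ≉0 : ∀ {n} → 1 ℕ.≤ n → ¬ fromℕ n ≈ 0#
  fromℕ≉0 {suc n} _ = char0 n

  ^≡^ᴱ : ∀ x n → x ^ n ≡ x Exp.^ n
  ^≡^ᴱ x zero = ≡.refl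
  ^≡^ᴱ x (suc n) = ≡.cong (x *_) (^≡^ᴱ x n)

  ^-+ : ∀ x m n → x ^ (m ℕ.+ n) ≈ x ^ m * x ^ n
  ^-+ x m n = begin
    x ^ (m ℕ.+ n)           ≡⟨ ^≡^ᴱ x (m ℕ.+ n) ⟩
    x Exp.^ (m ℕ.+ n)       ≈⟨ Exp.^-homo-* x m n ⟩
    x Exp.^ m * x Exp.^ n   ≡⟨ ≡.cong₂ _*_ (^≡^ᴱ x m) (^≡^ᴱ x n) ⟨
    x ^ m * x ^ n           ∎

  ^-* : ∀ x m n → x ^ (m ℕ.* n) ≈ (x ^ m) ^ n
  ^-* x m n = begin
    x ^ (m ℕ.* n)           ≡⟨ ^≡^ᴱ x (m ℕ.* n) ⟩
    x Exp.^ (m ℕ.* n)       ≈⟨ Exp.^-assocʳ x m n ⟨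
    (x Exp.^ m) Exp.^ n     ≡⟨ ≡.cong (Exp._^ n) (^≡^ᴱ x m) ⟨
    (x ^ m) Exp.^ n         ≡⟨ ^≡^ᴱ (x ^ m) n ⟨
    (x ^ m) ^ n             ∎

  ^-congˡ : ∀ {x y} n → x ≈ y → x ^ n ≈ y ^ n
  ^-congˡ zero x≈y = refl
  ^-congˡ (suc n) x≈y = *-cong x≈y (^-congˡ n x≈y)

  1^ : ∀ n → 1# ^ n ≈ 1#
  1^ zero = refl
  1^ (suc n) = trans (*-identityˡ _) (1^ n)

  infixl 6 _+≈_ _-≈_
  _+≈_ : ∀ {x y u v} → x ≈ y → u ≈ v → x + u ≈ y + v
  _+≈_ = +-cong

  _-≈_ : ∀ {x y u v} → x ≈ y → u ≈ v → x - u ≈ y - v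
  x≈y -≈ u≈v = +-cong x≈y (-‿cong u≈v)

  x≉0∧y≉0⇒x*y≉0 : ∀ {x y} → ¬ x ≈ 0# → ¬ y ≈ 0# → ¬ x * y ≈ 0#
  x≉0∧y≉0⇒x*y≉0 {x} {y} x≉0 y≉0 xy≈0 = y≉0 (begin
    y                   ≈⟨ *-identityˡ y ⟨
    1# * y              ≈⟨ *-congʳ (trans (*-comm (x ⁻¹) x) (⁻¹-inverse x x≉0)) ⟨
    (x ⁻¹ * x) * y      ≈⟨ *-assoc _ _ _ ⟩
    x ⁻¹ * (x * y)      ≈⟨ *-congˡ xy≈0 ⟩
    x ⁻¹ * 0#           ≈⟨ zeroʳ _ ⟩
    0#                  ∎)

  /-*-cancelʳ : ∀ x {y} → ¬ y ≈ 0# → (x / y) * y ≈ x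
  /-*-cancelʳ x {y} y≉0 = trans (*-assoc x (y ⁻¹) y) (trans (*-congˡ (trans (*-comm _ _) (⁻¹-inverse y y≉0))) (*-identityʳ x))

  *-cancelʳ-≉0 : ∀ {x y d} → ¬ d ≈ 0# → x * d ≈ y * d → x ≈ y
  *-cancelʳ-≉0 {x} {y} {d} d≉0 xd≈yd = begin
    x                 ≈⟨ /-*-cancelʳ x d≉0 ⟨
    (x * d ⁻¹) * d    ≈⟨ solve 3 (λ x d i → (x :* i) :* d := (x :* d) :* i) refl x d (d ⁻¹) ⟩
    (x * d) * d ⁻¹    ≈⟨ *-congʳ xd≈yd ⟩
    (y * d) * d ⁻¹    ≈⟨ solve 3 (λ y d i → (y :* d) :* i := (y :* i) :* d) refl y d (d ⁻¹) ⟩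
    (y * d ⁻¹) * d    ≈⟨ /-*-cancelʳ y d≉0 ⟩
    y                 ∎

  x-1≈0⇒x≈1 : ∀ {x} → x - 1# ≈ 0# → x ≈ 1#
  x-1≈0⇒x≈1 {x} x-1≈0 = begin
    x                  ≈⟨ solve 1 (λ x → x := (x :- con 1ℤ) :+ con 1ℤ) refl x ⟩
    (x - 1#) + 1#      ≈⟨ +-congʳ x-1≈0 ⟩
    0# + 1#            ≈⟨ +-identityˡ 1# ⟩
    1#                 ∎

  x≉1⇒x-1≉0 : ∀ {x} → ¬ x ≈ 1# → ¬ x - 1# ≈ 0#
  x≉1⇒x-1≉0 x≉1 = x≉1 ∘ x-1≈0⇒x≈1

  ∑-const : ∀ n x → ∑[ i < n ] x ≈ x * fromℕ n
  ∑-const zero x = sym (zeroʳ x)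
  ∑-const (suc n) x = begin
    ∑[ i < n ] x + x         ≈⟨ +-congʳ (∑-const n x) ⟩
    x * fromℕ n + x          ≈⟨ solve 2 (λ x m → x :* m :+ x := x :* (con 1ℤ :+ m)) refl x (fromℕ n) ⟩
    x * (1# + fromℕ n)       ∎

  ∑-distrib-minus : ∀ n f g → ∑[ i < n ] (f i - g i) ≈ ∑< n f - ∑< n g
  ∑-distrib-minus zero f g = sym (-‿inverseʳ 0#)
  ∑-distrib-minus (suc n) f g = begin
    ∑[ i < n ] (f i - g i) + (f n - g n)               ≈⟨ +-congʳ (∑-distrib-minus n f g) ⟩
    (∑< n f - ∑< n g) + (f n - g n)                    ≈⟨ solve 4 (λ s t u v → (s :- t) :+ (u :- v) := (s :+ u) :- (t :+ v)) refl _ _ _ _ ⟩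
    (∑< n f + f n) - (∑< n g + g n)                    ∎

  weightedSum-as-∑ : ∀ x N (L : List ℕ) → Unique L → (∀ {n} → n ∈ L → n ℕ.< N) →
    weightedSum x L ≈ ∑[ n < N ] (𝟙 (n ∈? L) * (x ^ n * fromℕ n))
  weightedSum-as-∑ x N [] _ _ = sym (∑-zero N (λ n _ → zeroˡ _))
  weightedSum-as-∑ x N (m ∷ L) (m∉L ∷ L-unique) L<N = begin
    term m + weightedSum x L
      ≈⟨ +-cong (sym (∑-𝟙-≡ N m term (L<N (here ≡.refl)))) (weightedSum-as-∑ x N L L-unique (L<N ∘ there)) ⟩
    ∑[ n < N ] (𝟙 (n ℕ.≟ m) * term n) + ∑[ n < N ] (𝟙 (n ∈? L) * term n)
      ≈⟨ ∑-distrib-+ N _ _ ⟨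
    ∑[ n < N ] (𝟙 (n ℕ.≟ m) * term n + 𝟙 (n ∈? L) * term n)
      ≈⟨ ∑-cong N (λ n _ → trans (*-congʳ (𝟙-∷ n)) (distribʳ (term n) _ _)) ⟨
    ∑[ n < N ] (𝟙 (n ∈? m ∷ L) * term n)
      ∎
    where
    term : ℕ → Carrier
    term n = x ^ n * fromℕ n
    𝟙-∷ : ∀ n → 𝟙 (n ∈? m ∷ L) ≈ 𝟙 (n ℕ.≟ m) + 𝟙 (n ∈? L)
    𝟙-∷ n with n ∈? m ∷ L | n ℕ.≟ m | n ∈? L
    ... | _ | yes ≡.refl | yes n∈L = contradiction ≡.refl (All.lookup m∉L n∈L)
    ... | yes _ | yes ≡.refl | no _ = sym (+-identityʳ 1#)
    ... | yes _ | no _ | yes _ = sym (+-identityˡ 1#)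
    ... | yes (here n≡m) | no n≢m | no _ = contradiction n≡m n≢m
    ... | yes (there n∈L) | no _ | no n∉L = contradiction n∈L n∉L
    ... | no n∉m∷L | yes ≡.refl | no _ = contradiction (here ≡.refl) n∉m∷L
    ... | no n∉m∷L | no _ | yes n∈L = contradiction (there n∈L) n∉m∷L
    ... | no _ | no _ | no _ = sym (+-identityʳ 0#)

  gauss : ∀ n → fromℕ 2 * ∑[ i < n ] fromℕ i ≈ fromℕ n * (fromℕ n - 1#)
  gauss zero = trans (zeroʳ _) (sym (zeroˡ _))
  gauss (suc n) = begin
    fromℕ 2 * (∑[ i < n ] fromℕ i + fromℕ n)           ≈⟨ distribˡ _ _ _ ⟩
    fromℕ 2 * ∑[ i < n ] fromℕ i + fromℕ 2 * fromℕ n   ≈⟨ +-congʳ (gauss n) ⟩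
    fromℕ n * (fromℕ n - 1#) + fromℕ 2 * fromℕ n       ≈⟨ +-congˡ (*-congʳ (+-congˡ (+-identityʳ 1#))) ⟩
    fromℕ n * (fromℕ n - 1#) + (1# + 1#) * fromℕ n
      ≈⟨ solve 1 (λ m → m :* (m :- con 1ℤ) :+ (con 1ℤ :+ con 1ℤ) :* m := (con 1ℤ :+ m) :* ((con 1ℤ :+ m) :- con 1ℤ))
                 refl (fromℕ n) ⟩
    (1# + fromℕ n) * ((1# + fromℕ n) - 1#)             ∎

  geometric : ∀ x n → (x - 1#) * ∑[ i < n ] x ^ i ≈ x ^ n - 1#
  geometric x zero = trans (zeroʳ _) (sym (-‿inverseʳ 1#))
  geometric x (suc n) = begin
    (x - 1#) * (∑[ i < n ] x ^ i + x ^ n)            ≈⟨ distribˡ _ _ _ ⟩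
    (x - 1#) * ∑[ i < n ] x ^ i + (x - 1#) * x ^ n   ≈⟨ +-congʳ (geometric x n) ⟩
    (x ^ n - 1#) + (x - 1#) * x ^ n
      ≈⟨ solve 2 (λ x X → (X :- con 1ℤ) :+ (x :- con 1ℤ) :* X := x :* X :- con 1ℤ) refl x (x ^ n) ⟩
    x * x ^ n - 1#                                   ∎

  weighted-geometric : ∀ x n →
    (x - 1#) * (x - 1#) * ∑[ i < n ] (x ^ i * fromℕ i) ≈ x ^ n * (fromℕ n * (x - 1#) - x) + x
  weighted-geometric x zero =
    solve 1 (λ x → (x :- con 1ℤ) :* (x :- con 1ℤ) :* con 0ℤ := con 1ℤ :* (con 0ℤ :* (x :- con 1ℤ) :- x) :+ x) refl x
  weighted-geometric x (suc n) = begin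
    (x - 1#) * (x - 1#) * (∑[ i < n ] (x ^ i * fromℕ i) + x ^ n * fromℕ n)
      ≈⟨ distribˡ _ _ _ ⟩
    (x - 1#) * (x - 1#) * ∑[ i < n ] (x ^ i * fromℕ i) + (x - 1#) * (x - 1#) * (x ^ n * fromℕ n)
      ≈⟨ +-congʳ (weighted-geometric x n) ⟩
    (x ^ n * (fromℕ n * (x - 1#) - x) + x) + (x - 1#) * (x - 1#) * (x ^ n * fromℕ n)
      ≈⟨ solve 3 (λ x X m → (X :* (m :* (x :- con 1ℤ) :- x) :+ x) :+ (x :- con 1ℤ) :* (x :- con 1ℤ) :* (X :* m)
                         := (x :* X) :* ((con 1ℤ :+ m) :* (x :- con 1ℤ) :- x) :+ x)
                 refl x (x ^ n) (fromℕ n) ⟩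
    (x * x ^ n) * ((1# + fromℕ n) * (x - 1#) - x) + x
      ∎

  module ArithmeticoGeometric (x : Carrier) (a : ℕ) where
    μ : Carrier
    μ = x ^ a

    term : ℕ → Carrier
    term n = x ^ n * fromℕ n

    φ : ℕ → Carrier
    φ n = x ^ n * (fromℕ n * (μ - 1#) - fromℕ a * μ)

    φ-step : ∀ m → φ m + (μ - 1#) * (μ - 1#) * term m ≈ φ (m ℕ.+ a)
    φ-step m = begin
      φ m + (μ - 1#) * (μ - 1#) * term m
        ≈⟨ solve 4 (λ X μ m a → X :* (m :* (μ :- con 1ℤ) :- a :* μ) :+ (μ :- con 1ℤ) :* (μ :- con 1ℤ) :* (X :* m)
                             := (X :* μ) :* ((m :+ a) :* (μ :- con 1ℤ) :- a :* μ))
                   refl (x ^ m) μ (fromℕ m) (fromℕ a) ⟩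
      (x ^ m * μ) * ((fromℕ m + fromℕ a) * (μ - 1#) - fromℕ a * μ)
        ≈⟨ *-cong (^-+ x m a) (+-congʳ (*-congʳ (fromℕ-+ m a))) ⟨
      φ (m ℕ.+ a)
        ∎

    ∑-progression : ∀ r t → (μ - 1#) * (μ - 1#) * ∑[ i < t ] term (r ℕ.+ i ℕ.* a) ≈ φ (r ℕ.+ t ℕ.* a) - φ r
    ∑-progression r zero = begin
      (μ - 1#) * (μ - 1#) * 0#   ≈⟨ zeroʳ _ ⟩
      0#                         ≈⟨ -‿inverseʳ (φ r) ⟨
      φ r - φ r                  ≡⟨ ≡.cong (λ n → φ n - φ r) (ℕ.+-identityʳ r) ⟨
      φ (r ℕ.+ 0) - φ r          ∎
    ∑-progression r (suc t) = begin
      (μ - 1#) * (μ - 1#) * (∑[ i < t ] term (r ℕ.+ i ℕ.* a) + term m)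
        ≈⟨ distribˡ _ _ _ ⟩
      (μ - 1#) * (μ - 1#) * ∑[ i < t ] term (r ℕ.+ i ℕ.* a) + (μ - 1#) * (μ - 1#) * term m
        ≈⟨ +-congʳ (∑-progression r t) ⟩
      (φ m - φ r) + (μ - 1#) * (μ - 1#) * term m
        ≈⟨ solve 3 (λ u v w → (u :- v) :+ w := (u :+ w) :- v) refl (φ m) (φ r) _ ⟩
      (φ m + (μ - 1#) * (μ - 1#) * term m) - φ r
        ≈⟨ +-congʳ (φ-step m) ⟩
      φ (m ℕ.+ a) - φ r
        ≡⟨ ≡.cong (λ n → φ n - φ r) m+a≡ ⟩
      φ (r ℕ.+ suc t ℕ.* a) - φ r
        ∎
      where
      m = r ℕ.+ t ℕ.* a
      m+a≡ : m ℕ.+ a ≡ r ℕ.+ suc t ℕ.* a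
      m+a≡ = ≡.trans (ℕ.+-assoc r (t ℕ.* a) a) (≡.cong (r ℕ.+_) (ℕ.+-comm (t ℕ.* a) a))

module _ where
  open import Data.Nat.Base using (_+_; _*_; _∸_)
  open import Data.Nat.Divisibility
  open import Data.Nat.GCD
  open import Data.Nat.LCM
  open import Data.Nat.Coprimality as Coprimality using (Coprime; coprime-divisor)
  open import Data.Nat.DivMod
  open import Data.Nat.Tactic.RingSolver using (solve-∀)
  open import Data.List.Extrema.Nat using (max; xs≤max)
  open import Relation.Binary.PropositionalEquality as ≡ using (refl; sym; trans; cong; cong₂; subst)

  coprime-*-∣ : ∀ {m n o} → Coprime m n → m ∣ o → n ∣ o → m * n ∣ o
  coprime-*-∣ {m} {n} m⊥n m∣o (divides q o≡q*n) =
    subst (m * n ∣_) (sym o≡q*n) (*-monoˡ-∣ n (coprime-divisor m⊥n (subst (m ∣_) (trans o≡q*n (ℕ.*-comm q n)) m∣o)))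

  a≡gcd[a,b]*gcd[a,c] : ∀ a b c → gcd (gcd a b) c ≡ 1 → a ∣ lcm b c → a ≡ gcd a b * gcd a c
  a≡gcd[a,b]*gcd[a,c] a b c gcd≡1 a∣lcm = ∣-antisym a∣gh gh∣a
    where
    g = gcd a b
    h = gcd a c
    g⊥h : Coprime g h
    g⊥h (d∣g , d∣h) = Coprimality.gcd≡1⇒coprime gcd≡1 (d∣g , ∣-trans d∣h (gcd[m,n]∣n a c))
    gh∣a : g * h ∣ a
    gh∣a = coprime-*-∣ g⊥h (gcd[m,n]∣m a b) (gcd[m,n]∣m a c)
    a∣bc : a ∣ b * c
    a∣bc = ∣-trans a∣lcm (∣-trans (∣n⇒∣m*n (gcd b c) ∣-refl) (∣-reflexive (gcd*lcm b c)))
    a∣hb : a ∣ h * b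
    a∣hb = subst (a ∣_) (trans (sym (c*gcd[m,n]≡gcd[cm,cn] b a c)) (ℕ.*-comm b h))
             (gcd-greatest (∣n⇒∣m*n b ∣-refl) a∣bc)
    a∣gh : a ∣ g * h
    a∣gh = subst (a ∣_) (trans (sym (c*gcd[m,n]≡gcd[cm,cn] h a b)) (ℕ.*-comm h g))
             (gcd-greatest (∣n⇒∣m*n h ∣-refl) a∣hb)

  a≡gcd*k⇒lcm≡k*b : ∀ a b k → 1 ≤ a → a ≡ gcd a b * k → lcm a b ≡ k * b
  a≡gcd*k⇒lcm≡k*b a b k a≥1 a≡gk = ℕ.*-cancelˡ-≡ (lcm a b) (k * b) (gcd a b) {{g≢0}}
    (trans (gcd*lcm a b) (trans (cong (_* b) a≡gk) (ℕ.*-assoc (gcd a b) k b)))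
    where
    g≢0 : NonZero (gcd a b)
    g≢0 = ℕ.≢-nonZero (gcd[m,n]≢0 a b (inj₁ (λ a≡0 → ℕ.<-irrefl (sym a≡0) a≥1)))

  ∣∧<⇒≡0 : ∀ {k d} → k ∣ d → d < k → d ≡ 0
  ∣∧<⇒≡0 {d = zero} _ _ = refl
  ∣∧<⇒≡0 {d = suc d} k∣d d<k = contradiction (∣⇒≤ k∣d) (ℕ.<⇒≱ d<k)

  private
    coprime-offset-unique-≤ : ∀ {k v X X′ s s′} → Coprime k v → k ∣ X → k ∣ X′ → s ≤ s′ → s′ < k →
      X + s * v ≡ X′ + s′ * v → s ≡ s′
    coprime-offset-unique-≤ {k} {v} {X} {X′} {s} {s′} k⊥v k∣X k∣X′ s≤s′ s′<k eq =
      trans (sym (ℕ.+-identityʳ s)) (trans (cong (s +_) (sym d≡0)) (ℕ.m+[n∸m]≡n s≤s′))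
      where
      d = s′ ∸ s
      X≡X′+dv : X ≡ X′ + d * v
      X≡X′+dv = ℕ.+-cancelʳ-≡ (s * v) X (X′ + d * v) (begin
        X + s * v             ≡⟨ eq ⟩
        X′ + s′ * v           ≡⟨ cong (λ t → X′ + t * v) (ℕ.m+[n∸m]≡n s≤s′) ⟨
        X′ + (s + d) * v      ≡⟨ cong (X′ +_) (trans (ℕ.*-distribʳ-+ v s d) (ℕ.+-comm (s * v) (d * v))) ⟩
        X′ + (d * v + s * v)  ≡⟨ ℕ.+-assoc X′ (d * v) (s * v) ⟨
        X′ + d * v + s * v    ∎)
        where open ≡.≡-Reasoning
      d≡0 : d ≡ 0
      d≡0 = ∣∧<⇒≡0 (coprime-divisor k⊥v (subst (k ∣_) (ℕ.*-comm d v) (∣m+n∣m⇒∣n (subst (k ∣_) X≡X′+dv k∣X) k∣X′)))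
              (ℕ.≤-<-trans (ℕ.m∸n≤m s′ s) s′<k)

  coprime-offset-unique : ∀ {k v X X′ s s′} → Coprime k v → k ∣ X → k ∣ X′ → s < k → s′ < k →
    X + s * v ≡ X′ + s′ * v → s ≡ s′
  coprime-offset-unique {s = s} {s′} k⊥v k∣X k∣X′ s<k s′<k eq with ℕ.≤-total s s′
  ... | inj₁ s≤s′ = coprime-offset-unique-≤ k⊥v k∣X k∣X′ s≤s′ s′<k eq
  ... | inj₂ s′≤s = sym (coprime-offset-unique-≤ k⊥v k∣X′ k∣X s′≤s s<k (sym eq))

  module ReducedRepresentations (a b c : ℕ) (a≥1 : 1 ≤ a)
                                (gcd≡1 : gcd (gcd a b) c ≡ 1) (a∣lcm : a ∣ lcm b c) where

    g h : ℕ
    g = gcd a b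
    h = gcd a c

    a≡g*h : a ≡ g * h
    a≡g*h = a≡gcd[a,b]*gcd[a,c] a b c gcd≡1 a∣lcm

    lcm[a,b]≡h*b : lcm a b ≡ h * b
    lcm[a,b]≡h*b = a≡gcd*k⇒lcm≡k*b a b h a≥1 a≡g*h

    lcm[a,c]≡g*c : lcm a c ≡ g * c
    lcm[a,c]≡g*c = a≡gcd*k⇒lcm≡k*b a c g a≥1 (trans a≡g*h (ℕ.*-comm g h))

    instance
      a≢0 : NonZero a
      a≢0 = ℕ.>-nonZero a≥1
      g≢0 : NonZero g
      g≢0 = ℕ.m*n≢0⇒m≢0 g {{subst NonZero a≡g*h a≢0}}
      h≢0 : NonZero h
      h≢0 = ℕ.m*n≢0⇒n≢0 g {{subst NonZero a≡g*h a≢0}}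

    private
      b′ c′ : ℕ
      b′ = _∣_.quotient (m∣lcm[m,n] a b)
      c′ = _∣_.quotient (m∣lcm[m,n] a c)

      h*b≡b′*a : h * b ≡ b′ * a
      h*b≡b′*a = trans (sym lcm[a,b]≡h*b) (_∣_.equality (m∣lcm[m,n] a b))

      g*c≡c′*a : g * c ≡ c′ * a
      g*c≡c′*a = trans (sym lcm[a,c]≡g*c) (_∣_.equality (m∣lcm[m,n] a c))

    -- Opaque so that type checking never unfolds the witnesses, built from _/_, _%_ and
    -- ring-solver proofs.
    opaque
      reduce : ∀ x y z → ∃ λ x′ → ∃ λ y′ → ∃ λ z′ →
        y′ < h × z′ < g × x * a + y * b + z * c ≡ x′ * a + y′ * b + z′ * c
      reduce x y z = x + (y / h) * b′ + (z / g) * c′ , y % h , z % g , m%n<n y h , m%n<n z g , (begin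
        x * a + y * b + z * c
          ≡⟨ cong₂ (λ u v → x * a + u * b + v * c) (m≡m%n+[m/n]*n y h) (m≡m%n+[m/n]*n z g) ⟩
        x * a + (y % h + (y / h) * h) * b + (z % g + (z / g) * g) * c
          ≡⟨ expand x (y % h) (y / h) h b (z % g) (z / g) g c a ⟩
        x * a + y % h * b + z % g * c + (y / h) * (h * b) + (z / g) * (g * c)
          ≡⟨ cong₂ (λ u v → x * a + y % h * b + z % g * c + (y / h) * u + (z / g) * v) h*b≡b′*a g*c≡c′*a ⟩
        x * a + y % h * b + z % g * c + (y / h) * (b′ * a) + (z / g) * (c′ * a)
          ≡⟨ collect x (y % h) (y / h) b′ (z % g) (z / g) c′ b c a ⟩
        (x + (y / h) * b′ + (z / g) * c′) * a + y % h * b + z % g * c ∎)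
        where
        open ≡.≡-Reasoning
        expand : ∀ x yr yq h b zr zq g c a → x * a + (yr + yq * h) * b + (zr + zq * g) * c
                                             ≡ x * a + yr * b + zr * c + yq * (h * b) + zq * (g * c)
        expand = solve-∀
        collect : ∀ x yr yq b′ zr zq c′ b c a → x * a + yr * b + zr * c + yq * (b′ * a) + zq * (c′ * a)
                                                 ≡ (x + yq * b′ + zq * c′) * a + yr * b + zr * c
        collect = solve-∀

    reduced-unique : ∀ {x y z x′ y′ z′} → y < h → z < g → y′ < h → z′ < g →
      x * a + y * b + z * c ≡ x′ * a + y′ * b + z′ * c → y ≡ y′ × z ≡ z′
    reduced-unique {x} {y} {z} {x′} {y′} {z′} y<h z<g y′<h z′<g eq = y≡y′ , z≡z′
      where
      g⊥c : Coprime g c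
      g⊥c = Coprimality.gcd≡1⇒coprime gcd≡1
      h⊥b : Coprime h b
      h⊥b = Coprimality.gcd≡1⇒coprime (trans (trans (gcd-assoc a c b) (trans (cong (gcd a) (gcd-comm c b)) (sym (gcd-assoc a b c)))) gcd≡1)
      g∣xa+yb : ∀ x y → g ∣ x * a + y * b
      g∣xa+yb x y = ∣m∣n⇒∣m+n (∣n⇒∣m*n x (gcd[m,n]∣m a b)) (∣n⇒∣m*n y (gcd[m,n]∣n a b))
      z≡z′ : z ≡ z′
      z≡z′ = coprime-offset-unique g⊥c (g∣xa+yb x y) (g∣xa+yb x′ y′) z<g z′<g eq
      y≡y′ : y ≡ y′
      y≡y′ = coprime-offset-unique h⊥b (∣n⇒∣m*n x (gcd[m,n]∣m a c)) (∣n⇒∣m*n x′ (gcd[m,n]∣m a c)) y<h y′<h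
               (ℕ.+-cancelʳ-≡ (z * c) _ _ (trans eq (cong (λ t → x′ * a + y′ * b + t * c) (sym z≡z′))))

  representable? : ∀ {a b c} → 1 ≤ a → 1 ≤ b → 1 ≤ c → ∀ n → Dec (Representable a b c n)
  representable? {a} {b} {c} a≥1 b≥1 c≥1 n
    with ℕ.anyUpTo? (λ x → ℕ.anyUpTo? (λ y → ℕ.anyUpTo? (λ z → x * a + y * b + z * c ℕ.≟ n) (suc n)) (suc n)) (suc n)
  ... | yes (x , _ , y , _ , z , _ , eq) = yes (x , y , z , eq)
  ... | no none = no λ (x , y , z , eq) → let (x≤ , y≤ , z≤) = coefficients≤ eq in
                    none (x , s≤s x≤ , y , s≤s y≤ , z , s≤s z≤ , eq)
    where
    ≤-coefficient : ∀ {k t s n} → 1 ≤ k → t * k ≤ s → s ≡ n → t ≤ n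
    ≤-coefficient {k} {t} (s≤s _) tk≤s refl = ℕ.≤-trans (ℕ.m≤m*n t k) tk≤s
    coefficients≤ : ∀ {x y z} → x * a + y * b + z * c ≡ n → x ≤ n × y ≤ n × z ≤ n
    coefficients≤ {x} {y} {z} eq =
      ≤-coefficient a≥1 (ℕ.≤-trans (ℕ.m≤m+n (x * a) (y * b)) (ℕ.m≤m+n _ (z * c))) eq ,
      ≤-coefficient b≥1 (ℕ.≤-trans (ℕ.m≤n+m (y * b) (x * a)) (ℕ.m≤m+n _ (z * c))) eq ,
      ≤-coefficient c≥1 (ℕ.m≤n+m (z * c) _) eq

  module NonRepresentables (a b c : ℕ) (a≥1 : 1 ≤ a) (b≥1 : 1 ≤ b) (c≥1 : 1 ≤ c)
                           (gcd≡1 : gcd (gcd a b) c ≡ 1) (a∣lcm : a ∣ lcm b c)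
                           (NR : List ℕ) (NR-spec : ∀ n → n ∈ NR ⇔ InNR a b c n) where

    open ReducedRepresentations a b c a≥1 gcd≡1 a∣lcm public

    M : ℕ
    M = suc (max 0 NR)

    ∈NR⇒<M : ∀ {n} → n ∈ NR → n < M
    ∈NR⇒<M n∈NR = s≤s (All.lookup (xs≤max 0 NR) n∈NR)

    -- Opaque so that type checking never runs the exhaustive search of representable?.
    opaque
      representable-≥M : ∀ n → M ≤ n → Representable a b c n
      representable-≥M n M≤n with representable? a≥1 b≥1 c≥1 n
      ... | yes rep = rep
      ... | no ¬rep = contradiction (∈NR⇒<M (Equivalence.from (NR-spec n) (ℕ.≤-trans (s≤s z≤n) M≤n , ¬rep))) (ℕ.≤⇒≯ M≤n)

    least-in-class : ∀ r → r < a → ∃ λ y → ∃ λ z → ∃ λ t → y < h × z < g × y * b + z * c ≡ r + t * a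
    least-in-class r r<a with representable-≥M (r + M * a) (ℕ.≤-trans (ℕ.m≤m*n M a) (ℕ.m≤n+m (M * a) r))
    ... | x , y , z , eq with reduce x y z
    ... | x′ , y′ , z′ , y′<h , z′<g , eq′ = y′ , z′ , M ∸ x′ , y′<h , z′<g , s≡r+[M∸x′]*a
      where
      s = y′ * b + z′ * c
      x′a+s≡r+Ma : x′ * a + s ≡ r + M * a
      x′a+s≡r+Ma = trans (sym (ℕ.+-assoc (x′ * a) (y′ * b) (z′ * c))) (trans (sym eq′) eq)
      x′≤M : x′ ≤ M
      x′≤M = ℕ.≮⇒≥ λ M<x′ → ℕ.<-irrefl refl
        (ℕ.≤-<-trans (ℕ.≤-trans (ℕ.*-monoˡ-≤ a M<x′) (ℕ.≤-trans (ℕ.m≤m+n (x′ * a) s) (ℕ.≤-reflexive x′a+s≡r+Ma)))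
                     (ℕ.+-monoˡ-< (M * a) r<a))
      s≡r+[M∸x′]*a : s ≡ r + (M ∸ x′) * a
      s≡r+[M∸x′]*a = ℕ.+-cancelˡ-≡ (x′ * a) s (r + (M ∸ x′) * a) (begin
        x′ * a + s                    ≡⟨ x′a+s≡r+Ma ⟩
        r + M * a                     ≡⟨ cong (λ m → r + m * a) (ℕ.m+[n∸m]≡n x′≤M) ⟨
        r + (x′ + (M ∸ x′)) * a       ≡⟨ shuffle r x′ (M ∸ x′) a ⟩
        x′ * a + (r + (M ∸ x′) * a)   ∎)
        where
        open ≡.≡-Reasoning
        shuffle : ∀ r x t a → r + (x + t) * a ≡ x * a + (r + t * a)
        shuffle = solve-∀

    least : ℕ → ℕ × ℕ × ℕ
    least r with r ℕ.<? a
    ... | yes r<a = let (y , z , t , _) = least-in-class r r<a in y , z , t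
    ... | no _ = 0 , 0 , 0

    Y Z T : ℕ → ℕ
    Y r = proj₁ (least r)
    Z r = proj₁ (proj₂ (least r))
    T r = proj₂ (proj₂ (least r))

    least-spec : ∀ {r} → r < a → Y r < h × Z r < g × Y r * b + Z r * c ≡ r + T r * a
    least-spec {r} r<a with r ℕ.<? a
    ... | yes r<a′ = proj₂ (proj₂ (proj₂ (least-in-class r r<a′)))
    ... | no r≮a = contradiction r<a r≮a

    module _ {r} (r<a : r < a) where
      private
        Y<h = proj₁ (least-spec r<a)
        Z<g = proj₁ (proj₂ (least-spec r<a))
        least-eq = proj₂ (proj₂ (least-spec r<a))

      representable-in-class : ∀ i → Representable a b c (r + i * a) ⇔ T r ≤ i
      representable-in-class i = mk⇔ T≤i (λ T≤i → i ∸ T r , Y r , Z r , witness T≤i)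
        where
        open ≡.≡-Reasoning
        T≤i : Representable a b c (r + i * a) → T r ≤ i
        T≤i (x , y , z , eq) with reduce x y z
        ... | x′ , y′ , z′ , y′<h , z′<g , eq′ = subst (T r ≤_) x′+T≡i (ℕ.m≤n+m (T r) x′)
          where
          shifted : (x′ + T r) * a + y′ * b + z′ * c ≡ i * a + Y r * b + Z r * c
          shifted = begin
            (x′ + T r) * a + y′ * b + z′ * c       ≡⟨ add-multiple x′ (T r) a (y′ * b) (z′ * c) ⟩
            (x′ * a + y′ * b + z′ * c) + T r * a   ≡⟨ cong (_+ T r * a) (trans (sym eq′) eq) ⟩
            (r + i * a) + T r * a                  ≡⟨ swap-sides r (i * a) (T r * a) ⟩
            i * a + (r + T r * a)                  ≡⟨ cong (i * a +_) least-eq ⟨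
            i * a + (Y r * b + Z r * c)            ≡⟨ ℕ.+-assoc (i * a) _ _ ⟨
            i * a + Y r * b + Z r * c              ∎
            where
            add-multiple : ∀ x t a u v → (x + t) * a + u + v ≡ (x * a + u + v) + t * a
            add-multiple = solve-∀
            swap-sides : ∀ r u v → (r + u) + v ≡ u + (r + v)
            swap-sides = solve-∀
          x′+T≡i : x′ + T r ≡ i
          x′+T≡i with reduced-unique {x = x′ + T r} {x′ = i} y′<h z′<g Y<h Z<g shifted
          ... | refl , refl = ℕ.*-cancelʳ-≡ (x′ + T r) i a (ℕ.+-cancelʳ-≡ _ _ _ (ℕ.+-cancelʳ-≡ _ _ _ shifted))
        witness : T r ≤ i → (i ∸ T r) * a + Y r * b + Z r * c ≡ r + i * a
        witness T≤i = begin
          (i ∸ T r) * a + Y r * b + Z r * c      ≡⟨ ℕ.+-assoc ((i ∸ T r) * a) _ _ ⟩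
          (i ∸ T r) * a + (Y r * b + Z r * c)    ≡⟨ cong ((i ∸ T r) * a +_) least-eq ⟩
          (i ∸ T r) * a + (r + T r * a)          ≡⟨ collect (i ∸ T r) (T r) r a ⟩
          r + (T r + (i ∸ T r)) * a              ≡⟨ cong (λ t → r + t * a) (ℕ.m+[n∸m]≡n T≤i) ⟩
          r + i * a                              ∎
          where
          collect : ∀ d t r a → d * a + (r + t * a) ≡ r + (t + d) * a
          collect = solve-∀

      ∈NR-in-class : ∀ i → (r + i * a) ∈ NR ⇔ i < T r
      ∈NR-in-class i = mk⇔
        (λ ∈NR → ℕ.≰⇒> (proj₂ (Equivalence.to (NR-spec _) ∈NR) ∘ Equivalence.from (representable-in-class i)))
        (λ i<T → Equivalence.from (NR-spec _) (positive i<T , ¬representable i<T))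
        where
        ¬representable : i < T r → ¬ Representable a b c (r + i * a)
        ¬representable i<T rep = ℕ.<⇒≱ i<T (Equivalence.to (representable-in-class i) rep)
        positive : i < T r → 1 ≤ r + i * a
        positive i<T with r + i * a in eq
        ... | zero = contradiction (subst (Representable a b c) (sym eq) (0 , 0 , 0 , refl)) (¬representable i<T)
        ... | suc _ = s≤s z≤n

      T≤M : T r ≤ M
      T≤M with T r in eq
      ... | zero = z≤n
      ... | suc j = ℕ.≤-trans (s≤s (ℕ.≤-trans (ℕ.m≤m*n j a) (ℕ.m≤n+m (j * a) r)))
                      (∈NR⇒<M (Equivalence.from (∈NR-in-class j) (ℕ.≤-reflexive (sym eq))))

    residue : ℕ → ℕ → ℕ
    residue y z = (y * b + z * c) % a

    residue<a : ∀ {y z} → y < h → z < g → residue y z < a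
    residue<a {y} {z} _ _ = m%n<n (y * b + z * c) a

    residue-least : ∀ {r} → r < a → Y r < h × Z r < g × residue (Y r) (Z r) ≡ r
    residue-least {r} r<a with least-spec r<a
    ... | Y<h , Z<g , eq = Y<h , Z<g , (begin
      (Y r * b + Z r * c) % a    ≡⟨ cong (_% a) eq ⟩
      (r + T r * a) % a          ≡⟨ [m+kn]%n≡m%n r (T r) a ⟩
      r % a                      ≡⟨ m<n⇒m%n≡m r<a ⟩
      r                          ∎)
      where open ≡.≡-Reasoning

    least-residue : ∀ {y z} → y < h → z < g → Y (residue y z) ≡ y × Z (residue y z) ≡ z
    least-residue {y} {z} y<h z<g with least-spec (residue<a y<h z<g)
    ... | Y<h , Z<g , eq = reduced-unique {x = q} {x′ = T r} Y<h Z<g y<h z<g (begin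
      q * a + Y r * b + Z r * c       ≡⟨ ℕ.+-assoc (q * a) _ _ ⟩
      q * a + (Y r * b + Z r * c)     ≡⟨ cong (q * a +_) eq ⟩
      q * a + (r + T r * a)           ≡⟨ rearrange q a r (T r) ⟩
      T r * a + (r + q * a)           ≡⟨ cong (T r * a +_) (m≡m%n+[m/n]*n m a) ⟨
      T r * a + (y * b + z * c)       ≡⟨ ℕ.+-assoc (T r * a) _ _ ⟨
      T r * a + y * b + z * c         ∎)
      where
      open ≡.≡-Reasoning
      m = y * b + z * c
      r = residue y z
      q = m / a
      rearrange : ∀ q a r t → q * a + (r + t * a) ≡ t * a + (r + q * a)
      rearrange = solve-∀

module Theorem7 {ℓc ℓe : Level} (F : CharZeroField ℓc ℓe) (a b c : ℕ)
               (a≥1 : 1 ≤ a) (b≥1 : 1 ≤ b) (c≥1 : 1 ≤ c)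
               (gcd≡1 : gcd (gcd a b) c ≡ 1) (a∣lcm : a ∣ lcm b c)
               (NR : List ℕ) (NR-unique : Unique NR) (NR-spec : ∀ n → n ∈ NR ⇔ InNR a b c n) where
  open CharZeroField F
  open FieldLemmas F
  open ℤ-CoefficientSolver cring using (solve; _:=_; _:+_; _:-_; :-_; _:*_; con)
  open NonRepresentables a b c a≥1 b≥1 c≥1 gcd≡1 a∣lcm NR NR-spec
  open import Relation.Binary.Reasoning.Setoid setoid

  module AtRootOfUnity (λ' : Carrier) (λᵃ≉1 : ¬ λ' ^ a ≈ 1#) (λᵇ≉1 : ¬ λ' ^ b ≈ 1#) (λᶜ≈1 : λ' ^ c ≈ 1#) where
    open ArithmeticoGeometric λ' a

    ν P A B L : Carrier
    ν = λ' ^ b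
    P = λ' ^ lcm a b
    A = μ - 1#
    B = ν - 1#
    L = λ' - 1#

    aᶠ bᶠ cᶠ gᶠ hᶠ two : Carrier
    aᶠ = fromℕ a
    bᶠ = fromℕ b
    cᶠ = fromℕ c
    gᶠ = fromℕ g
    hᶠ = fromℕ h
    two = fromℕ 2

    E : Carrier
    E = weightedSum λ' NR

    E≈∑classes : E ≈ ∑[ r < a ] ∑[ i < T r ] term (r ℕ.+ i ℕ.* a)
    E≈∑classes = begin
      E
        ≈⟨ weightedSum-as-∑ λ' (M ℕ.* a) NR NR-unique (λ n∈NR → ℕ.<-≤-trans (∈NR⇒<M n∈NR) (ℕ.m≤m*n M a)) ⟩
      ∑[ n < M ℕ.* a ] (𝟙 (n ∈? NR) * term n)
        ≈⟨ ∑-residues M a _ ⟩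
      ∑[ r < a ] ∑[ i < M ] (𝟙 (r ℕ.+ i ℕ.* a ∈? NR) * term (r ℕ.+ i ℕ.* a))
        ≈⟨ ∑-cong a (λ r r<a → ∑-cong M (λ i _ → *-congʳ (𝟙-cong (r ℕ.+ i ℕ.* a ∈? NR) (i ℕ.<? T r) (∈NR-in-class r<a i)))) ⟩
      ∑[ r < a ] ∑[ i < M ] (𝟙 (i ℕ.<? T r) * term (r ℕ.+ i ℕ.* a))
        ≈⟨ ∑-cong a (λ r r<a → ∑-𝟙-< M (T r) _ (T≤M r<a)) ⟩
      ∑[ r < a ] ∑[ i < T r ] term (r ℕ.+ i ℕ.* a)
        ∎

    A²E≈grid-residues : A * A * E ≈ ∑[ y < h ] ∑[ z < g ] φ (y ℕ.* b ℕ.+ z ℕ.* c) - ∑[ r < a ] φ r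
    A²E≈grid-residues = begin
      A * A * E
        ≈⟨ *-congˡ E≈∑classes ⟩
      A * A * ∑[ r < a ] ∑[ i < T r ] term (r ℕ.+ i ℕ.* a)
        ≈⟨ *-distribˡ-∑ a (A * A) _ ⟩
      ∑[ r < a ] (A * A * ∑[ i < T r ] term (r ℕ.+ i ℕ.* a))
        ≈⟨ ∑-cong a (λ r r<a → trans (∑-progression r (T r)) (+-congʳ (φ-least r<a))) ⟩
      ∑[ r < a ] (φ (Y r ℕ.* b ℕ.+ Z r ℕ.* c) - φ r)
        ≈⟨ ∑-distrib-minus a _ _ ⟩
      ∑[ r < a ] φ (Y r ℕ.* b ℕ.+ Z r ℕ.* c) - ∑[ r < a ] φ r
        ≈⟨ +-congʳ (∑-bijection a h g residue Y Z residue<a residue-least least-residue (λ y z → φ (y ℕ.* b ℕ.+ z ℕ.* c))) ⟩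
      ∑[ y < h ] ∑[ z < g ] φ (y ℕ.* b ℕ.+ z ℕ.* c) - ∑[ r < a ] φ r
        ∎
      where
      φ-least : ∀ {r} → r < a → φ (r ℕ.+ T r ℕ.* a) ≈ φ (Y r ℕ.* b ℕ.+ Z r ℕ.* c)
      φ-least r<a = reflexive (≡.cong φ (≡.sym (proj₂ (proj₂ (least-spec r<a)))))

    Y₀ Y₁ Z₁ R₀ R₁ : Carrier
    Y₀ = ∑[ y < h ] ν ^ y
    Y₁ = ∑[ y < h ] (ν ^ y * fromℕ y)
    Z₁ = ∑[ z < g ] fromℕ z
    R₀ = ∑[ r < a ] λ' ^ r
    R₁ = ∑[ r < a ] (λ' ^ r * fromℕ r)

    λ^[yb+zc]≈νʸ : ∀ y z → λ' ^ (y ℕ.* b ℕ.+ z ℕ.* c) ≈ ν ^ y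
    λ^[yb+zc]≈νʸ y z = begin
      λ' ^ (y ℕ.* b ℕ.+ z ℕ.* c)           ≈⟨ ^-+ λ' (y ℕ.* b) (z ℕ.* c) ⟩
      λ' ^ (y ℕ.* b) * λ' ^ (z ℕ.* c)      ≡⟨ ≡.cong₂ (λ m n → λ' ^ m * λ' ^ n) (ℕ.*-comm y b) (ℕ.*-comm z c) ⟩
      λ' ^ (b ℕ.* y) * λ' ^ (c ℕ.* z)      ≈⟨ *-cong (^-* λ' b y) (^-* λ' c z) ⟩
      ν ^ y * (λ' ^ c) ^ z                 ≈⟨ *-congˡ (trans (^-congˡ z λᶜ≈1) (1^ z)) ⟩
      ν ^ y * 1#                           ≈⟨ *-identityʳ _ ⟩
      ν ^ y                                ∎

    grid-closed : ∑[ y < h ] ∑[ z < g ] φ (y ℕ.* b ℕ.+ z ℕ.* c)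
                  ≈ (bᶠ * A * gᶠ) * Y₁ + (cᶠ * A * Z₁ - aᶠ * μ * gᶠ) * Y₀
    grid-closed = begin
      ∑[ y < h ] ∑[ z < g ] φ (y ℕ.* b ℕ.+ z ℕ.* c)
        ≈⟨ ∑-cong h (λ y _ → ∑-cong g (λ z _ → φ-grid y z)) ⟩
      ∑[ y < h ] ∑[ z < g ] (ν ^ y * (fromℕ y * bᶠ * A - aᶠ * μ) * 1# + ν ^ y * cᶠ * A * fromℕ z)
        ≈⟨ ∑-cong h (λ y _ → ∑-linear g _ _ (λ _ → 1#) fromℕ) ⟩
      ∑[ y < h ] (ν ^ y * (fromℕ y * bᶠ * A - aᶠ * μ) * ∑[ z < g ] 1# + ν ^ y * cᶠ * A * Z₁)
        ≈⟨ ∑-cong h (λ y _ → trans (+-congʳ (*-congˡ (∑-const g 1#))) (collect (ν ^ y) (fromℕ y))) ⟩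
      ∑[ y < h ] ((bᶠ * A * gᶠ) * (ν ^ y * fromℕ y) + (cᶠ * A * Z₁ - aᶠ * μ * gᶠ) * ν ^ y)
        ≈⟨ ∑-linear h _ _ _ _ ⟩
      (bᶠ * A * gᶠ) * Y₁ + (cᶠ * A * Z₁ - aᶠ * μ * gᶠ) * Y₀ ∎
      where
      φ-grid : ∀ y z → φ (y ℕ.* b ℕ.+ z ℕ.* c) ≈ ν ^ y * (fromℕ y * bᶠ * A - aᶠ * μ) * 1# + ν ^ y * cᶠ * A * fromℕ z
      φ-grid y z = begin
        φ (y ℕ.* b ℕ.+ z ℕ.* c)
          ≈⟨ *-cong (λ^[yb+zc]≈νʸ y z) (+-congʳ (*-congʳ (trans (fromℕ-+ (y ℕ.* b) (z ℕ.* c)) (+-cong (fromℕ-* y b) (fromℕ-* z c))))) ⟩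
        ν ^ y * ((fromℕ y * bᶠ + fromℕ z * cᶠ) * A - aᶠ * μ)
          ≈⟨ solve 8 (λ N y b z c A a μ → N :* ((y :* b :+ z :* c) :* A :- a :* μ)
                                        := N :* (y :* b :* A :- a :* μ) :* con 1ℤ :+ N :* c :* A :* z) refl
                     (ν ^ y) (fromℕ y) bᶠ (fromℕ z) cᶠ A aᶠ μ ⟩
        ν ^ y * (fromℕ y * bᶠ * A - aᶠ * μ) * 1# + ν ^ y * cᶠ * A * fromℕ z ∎
      collect : ∀ N n → N * (n * bᶠ * A - aᶠ * μ) * (1# * gᶠ) + N * cᶠ * A * Z₁
                        ≈ (bᶠ * A * gᶠ) * (N * n) + (cᶠ * A * Z₁ - aᶠ * μ * gᶠ) * N
      collect N n = solve 9 (λ N n b A a μ g c Z →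
          N :* (n :* b :* A :- a :* μ) :* (con 1ℤ :* g) :+ N :* c :* A :* Z
       := (b :* A :* g) :* (N :* n) :+ (c :* A :* Z :- a :* μ :* g) :* N) refl N n bᶠ A aᶠ μ gᶠ cᶠ Z₁

    residues-closed : ∑[ r < a ] φ r ≈ A * R₁ + (- (aᶠ * μ)) * R₀
    residues-closed = trans
      (∑-cong a (λ r _ → solve 5 (λ X n A a μ → X :* (n :* A :- a :* μ) := A :* (X :* n) :+ (:- (a :* μ)) :* X)
                                  refl (λ' ^ r) (fromℕ r) A aᶠ μ))
      (∑-linear a _ _ _ _)

    νʰ≈P : ν ^ h ≈ P
    νʰ≈P = trans (sym (^-* λ' b h)) (reflexive (≡.cong (λ' ^_) (≡.trans (ℕ.*-comm b h) (≡.sym lcm[a,b]≡h*b))))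

    R₀-closed : L * R₀ ≈ A
    R₀-closed = geometric λ' a

    R₁-closed : L * L * R₁ ≈ μ * (aᶠ * L - λ') + λ'
    R₁-closed = weighted-geometric λ' a

    Y₀-closed : B * Y₀ ≈ P - 1#
    Y₀-closed = trans (geometric ν h) (+-congʳ νʰ≈P)

    Y₁-closed : B * B * Y₁ ≈ P * (hᶠ * B - ν) + ν
    Y₁-closed = trans (weighted-geometric ν h) (+-congʳ (*-congʳ νʰ≈P))

    Z₁-closed : two * Z₁ ≈ gᶠ * (gᶠ - 1#)
    Z₁-closed = gauss g

    residues-cleared : L * L * (A * R₁ + (- (aᶠ * μ)) * R₀) ≈ - (λ' * A * A)
    residues-cleared = begin
      L * L * (A * R₁ + (- (aᶠ * μ)) * R₀)
        ≈⟨ solve 6 (λ L A R₁ a μ R₀ → L :* L :* (A :* R₁ :+ (:- (a :* μ)) :* R₀)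
                                   := A :* (L :* L :* R₁) :+ (:- (a :* μ)) :* L :* (L :* R₀))
                   refl L A R₁ aᶠ μ R₀ ⟩
      A * (L * L * R₁) + (- (aᶠ * μ)) * L * (L * R₀)
        ≈⟨ +-cong (*-congˡ R₁-closed) (*-congˡ R₀-closed) ⟩
      A * (μ * (aᶠ * L - λ') + λ') + (- (aᶠ * μ)) * L * A
        ≈⟨ solve 3 (λ μ λ' a → (μ :- con 1ℤ) :* (μ :* (a :* (λ' :- con 1ℤ) :- λ') :+ λ')
                                 :+ (:- (a :* μ)) :* (λ' :- con 1ℤ) :* (μ :- con 1ℤ)
                            := :- (λ' :* (μ :- con 1ℤ) :* (μ :- con 1ℤ)))
                   refl μ λ' aᶠ ⟩
      - (λ' * A * A)
        ∎

    D Δ : Carrier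
    D = cᶠ * A * B
    Δ = D * two * A * B * (L * L)

    W RHS : Carrier
    W = fromℕ (lcm a b) + (fromℕ (lcm a c) / two) - aᶠ - bᶠ - (cᶠ / two) - (aᶠ / A) - (bᶠ / B)
    RHS = ((((fromℕ (lcm a c) * (P - 1#)) / D) * W) + ((fromℕ (lcm a b) * fromℕ (lcm a c)) / D)) + (λ' / ((λ' - 1#) * (λ' - 1#)))

    A≉0 : ¬ A ≈ 0#
    A≉0 = x≉1⇒x-1≉0 λᵃ≉1
    B≉0 : ¬ B ≈ 0#
    B≉0 = x≉1⇒x-1≉0 λᵇ≉1
    L≉0 : ¬ L ≈ 0#
    L≉0 L≈0 = λᵃ≉1 (trans (^-congˡ a (x-1≈0⇒x≈1 L≈0)) (1^ a))
    two≉0 : ¬ two ≈ 0#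
    two≉0 = char0 1
    D≉0 : ¬ D ≈ 0#
    D≉0 = x≉0∧y≉0⇒x*y≉0 (x≉0∧y≉0⇒x*y≉0 (fromℕ≉0 c≥1) A≉0) B≉0
    L²≉0 : ¬ L * L ≈ 0#
    L²≉0 = x≉0∧y≉0⇒x*y≉0 L≉0 L≉0
    Δ≉0 : ¬ Δ ≈ 0#
    Δ≉0 = x≉0∧y≉0⇒x*y≉0 (x≉0∧y≉0⇒x*y≉0 (x≉0∧y≉0⇒x*y≉0 (x≉0∧y≉0⇒x*y≉0 D≉0 two≉0) A≉0) B≉0) L²≉0

    fromℕ-lcm[a,b] : fromℕ (lcm a b) ≈ hᶠ * bᶠ
    fromℕ-lcm[a,b] = trans (reflexive (≡.cong fromℕ lcm[a,b]≡h*b)) (fromℕ-* h b)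
    fromℕ-lcm[a,c] : fromℕ (lcm a c) ≈ gᶠ * cᶠ
    fromℕ-lcm[a,c] = trans (reflexive (≡.cong fromℕ lcm[a,c]≡g*c)) (fromℕ-* g c)
    aᶠ≈gᶠ*hᶠ : aᶠ ≈ gᶠ * hᶠ
    aᶠ≈gᶠ*hᶠ = trans (reflexive (≡.cong fromℕ a≡g*h)) (fromℕ-* g h)

    W′ : Carrier
    W′ = two * A * B * (hᶠ * bᶠ - gᶠ * hᶠ - bᶠ) + gᶠ * cᶠ * A * B - cᶠ * A * B - two * (gᶠ * hᶠ) * B - two * A * bᶠ

    W-cleared : W * (two * A * B) ≈ W′
    W-cleared = begin
      W * (two * A * B)
        ≈⟨ solve 10 (λ l₁ s₁ a b s₂ s₃ s₄ two A B →
               (l₁ :+ s₁ :- a :- b :- s₂ :- s₃ :- s₄) :* (two :* A :* B)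
            := two :* A :* B :* (l₁ :- a :- b) :+ s₁ :* two :* A :* B :- s₂ :* two :* A :* B :- two :* (s₃ :* A) :* B :- two :* A :* (s₄ :* B))
             refl (fromℕ (lcm a b)) (fromℕ (lcm a c) / two) aᶠ bᶠ (cᶠ / two) (aᶠ / A) (bᶠ / B) two A B ⟩
      two * A * B * (fromℕ (lcm a b) - aᶠ - bᶠ) + (fromℕ (lcm a c) / two) * two * A * B - (cᶠ / two) * two * A * B
        - two * ((aᶠ / A) * A) * B - two * A * ((bᶠ / B) * B)
        ≈⟨ *-congˡ (fromℕ-lcm[a,b] -≈ aᶠ≈gᶠ*hᶠ -≈ refl)
             +≈ *-congʳ (*-congʳ (trans (/-*-cancelʳ _ two≉0) fromℕ-lcm[a,c]))
             -≈ *-congʳ (*-congʳ (/-*-cancelʳ cᶠ two≉0))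
             -≈ *-congʳ (*-congˡ (trans (/-*-cancelʳ aᶠ A≉0) aᶠ≈gᶠ*hᶠ))
             -≈ *-congˡ (/-*-cancelʳ bᶠ B≉0) ⟩
      W′ ∎

    ΔRHS-polynomial : Carrier
    ΔRHS-polynomial = gᶠ * cᶠ * (P - 1#) * W′ * (L * L) + hᶠ * bᶠ * (gᶠ * cᶠ) * (two * A * B * (L * L)) + λ' * (D * two * A * B)

    RHS-cleared : RHS * Δ ≈ ΔRHS-polynomial
    RHS-cleared = begin
      RHS * Δ
        ≈⟨ solve 9 (λ q₁ w q₂ q₃ c A B L two →
               (q₁ :* w :+ q₂ :+ q₃) :* (c :* A :* B :* two :* A :* B :* (L :* L))
            := q₁ :* (c :* A :* B) :* (w :* (two :* A :* B)) :* (L :* L) :+ q₂ :* (c :* A :* B) :* (two :* A :* B :* (L :* L))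
                :+ q₃ :* (L :* L) :* (c :* A :* B :* two :* A :* B))
             refl ((fromℕ (lcm a c) * (P - 1#)) / D) W ((fromℕ (lcm a b) * fromℕ (lcm a c)) / D) (λ' / (L * L)) cᶠ A B L two ⟩
      ((fromℕ (lcm a c) * (P - 1#)) / D) * D * (W * (two * A * B)) * (L * L)
        + ((fromℕ (lcm a b) * fromℕ (lcm a c)) / D) * D * (two * A * B * (L * L))
        + (λ' / (L * L)) * (L * L) * (D * two * A * B)
        ≈⟨ *-congʳ (*-cong (trans (/-*-cancelʳ _ D≉0) (*-congʳ fromℕ-lcm[a,c])) W-cleared)
             +≈ *-congʳ (trans (/-*-cancelʳ _ D≉0) (*-cong fromℕ-lcm[a,b] fromℕ-lcm[a,c]))
             +≈ *-congʳ (/-*-cancelʳ λ' L²≉0) ⟩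
      ΔRHS-polynomial ∎

    ΔE-polynomial : Carrier
    ΔE-polynomial = two * cᶠ * bᶠ * A * gᶠ * (L * L) * (P * (hᶠ * B - ν) + ν)
                    + cᶠ * cᶠ * A * B * (L * L) * (P - 1#) * (gᶠ * (gᶠ - 1#))
                    - two * cᶠ * (gᶠ * hᶠ * μ * gᶠ) * B * (L * L) * (P - 1#)
                    - two * cᶠ * B * B * (- (λ' * A * A))

    E-cleared : E * Δ ≈ ΔE-polynomial
    E-cleared = begin
      E * Δ
        ≈⟨ solve 6 (λ E c A B two L → E :* (c :* A :* B :* two :* A :* B :* (L :* L)) := A :* A :* E :* (c :* B :* two :* B :* (L :* L)))
             refl E cᶠ A B two L ⟩
      A * A * E * (cᶠ * B * two * B * (L * L))
        ≈⟨ *-congʳ (trans A²E≈grid-residues (grid-closed -≈ residues-closed)) ⟩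
      ((bᶠ * A * gᶠ) * Y₁ + (cᶠ * A * Z₁ - aᶠ * μ * gᶠ) * Y₀ - (A * R₁ + (- (aᶠ * μ)) * R₀)) * (cᶠ * B * two * B * (L * L))
        ≈⟨ solve 14 (λ b A g Y₁ c Z₁ a μ Y₀ R₁ R₀ B two L →
               ((b :* A :* g) :* Y₁ :+ (c :* A :* Z₁ :- a :* μ :* g) :* Y₀ :- (A :* R₁ :+ (:- (a :* μ)) :* R₀)) :* (c :* B :* two :* B :* (L :* L))
            := two :* c :* b :* A :* g :* (L :* L) :* (B :* B :* Y₁)
                :+ c :* c :* A :* B :* (L :* L) :* (B :* Y₀) :* (two :* Z₁)
                :- two :* c :* (a :* μ :* g) :* B :* (L :* L) :* (B :* Y₀)
                :- two :* c :* B :* B :* (L :* L :* (A :* R₁ :+ (:- (a :* μ)) :* R₀)))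
             refl bᶠ A gᶠ Y₁ cᶠ Z₁ aᶠ μ Y₀ R₁ R₀ B two L ⟩
      two * cᶠ * bᶠ * A * gᶠ * (L * L) * (B * B * Y₁)
        + cᶠ * cᶠ * A * B * (L * L) * (B * Y₀) * (two * Z₁)
        - two * cᶠ * (aᶠ * μ * gᶠ) * B * (L * L) * (B * Y₀)
        - two * cᶠ * B * B * (L * L * (A * R₁ + (- (aᶠ * μ)) * R₀))
        ≈⟨ *-congˡ Y₁-closed
             +≈ *-cong (*-congˡ Y₀-closed) Z₁-closed
             -≈ *-cong (*-congʳ (*-congʳ (*-congˡ (*-congʳ (*-congʳ aᶠ≈gᶠ*hᶠ))))) Y₀-closed
             -≈ *-congˡ residues-cleared ⟩
      ΔE-polynomial ∎

    polynomials-agree : ΔE-polynomial ≈ ΔRHS-polynomial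
    polynomials-agree = solve 9 (λ μ ν λ' P g h b c two →
        let A = μ :- con 1ℤ
            B = ν :- con 1ℤ
            L = λ' :- con 1ℤ
            W′ = two :* A :* B :* (h :* b :- g :* h :- b) :+ g :* c :* A :* B :- c :* A :* B :- two :* (g :* h) :* B :- two :* A :* b
        in two :* c :* b :* A :* g :* (L :* L) :* (P :* (h :* B :- ν) :+ ν)
             :+ c :* c :* A :* B :* (L :* L) :* (P :- con 1ℤ) :* (g :* (g :- con 1ℤ))
             :- two :* c :* (g :* h :* μ :* g) :* B :* (L :* L) :* (P :- con 1ℤ)
             :- two :* c :* B :* B :* (:- (λ' :* A :* A))
         := g :* c :* (P :- con 1ℤ) :* W′ :* (L :* L) :+ h :* b :* (g :* c) :* (two :* A :* B :* (L :* L)) :+ λ' :* (c :* A :* B :* two :* A :* B))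
      refl μ ν λ' P gᶠ hᶠ bᶠ cᶠ two

theorem7 : ∀ {ℓc ℓe : Level} (F : CharZeroField ℓc ℓe) (a b c : ℕ) →
  1 ≤ a → 1 ≤ b → 1 ≤ c →
  gcd (gcd a b) c ≡ 1 →
  a ∣ lcm b c →
  (NR : List ℕ) → Unique NR → (∀ n → (n ∈ NR) ⇔ InNR a b c n) →
  let open CharZeroField F in
  (λ' : Carrier) →
  ¬ (λ' ≈ 0#) → ¬ ((λ' ^ a) ≈ 1#) → ¬ ((λ' ^ b) ≈ 1#) → (λ' ^ c) ≈ 1# →
  let l₁ = lcm a b
      l₂ = lcm a c
      A = (λ' ^ a) - 1#
      B = (λ' ^ b) - 1#
      D = fromℕ c * A * B
      two = fromℕ 2
  in weightedSum λ' NR ≈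
       ((((fromℕ l₂ * ((λ' ^ l₁) - 1#)) / D)
          * (fromℕ l₁ + (fromℕ l₂ / two) - fromℕ a - fromℕ b - (fromℕ c / two)
             - (fromℕ a / A) - (fromℕ b / B)))
        + ((fromℕ l₁ * fromℕ l₂) / D))
        + (λ' / ((λ' - 1#) * (λ' - 1#)))

theorem7 F a b c a≥1 b≥1 c≥1 gcd≡1 a∣lcm NR NR-unique NR-spec λ' _ λᵃ≉1 λᵇ≉1 λᶜ≈1 =
  *-cancelʳ-≉0 Δ≉0 (begin
    E * Δ             ≈⟨ E-cleared ⟩
    ΔE-polynomial     ≈⟨ polynomials-agree ⟩
    ΔRHS-polynomial   ≈⟨ RHS-cleared ⟨
    RHS * Δ           ∎)
  where
  open CharZeroField F using (setoid; _*_)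
  open import Relation.Binary.Reasoning.Setoid setoid
  open FieldLemmas F using (*-cancelʳ-≉0)
  open Theorem7 F a b c a≥1 b≥1 c≥1 gcd≡1 a∣lcm NR NR-unique NR-spec
  open AtRootOfUnity λ' λᵃ≉1 λᵇ≉1 λᶜ≈1
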